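{- Let $V,W$ be infinite disjoint sets with $V\cup W=\mathbb{N}$, and let $K_{V,W}$ be the complete bipartite graph with vertex classes $V$ and $W$. For every $k\in\mathbb{N}$ there exists a $k$-edge-colouring of $K_{V,W}$ in which every monochromatic path $P$ satisfies $\overline{d}(P)\le 1/k$.
   Context: A $k$-edge-colouring assigns to each edge one of the colours $1,\dots,k$; a monochromatic path is a path (finite or one-way infinite) all of whose edges have the same colour. For $A\subseteq \mathbb{N}$, $\overline{d}(A)=\limsup_{n\to\infty}|A\cap\{1,\dots,n\}|/n$, and for a graph $G$ with $V(G)\subseteq\mathbb{N}$, $\overline{d}(G)=\overline{d}(V(G))$. -}

module Defs where

open import Data.Nat using (ℕ; zero; suc; _+_; _*_; _≤_; _<_)
open import Data.Bool using (Bool; true; false)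
open import Data.Fin using (Fin; toℕ; inject₁) renaming (suc to fsuc)
open import Data.List using (List; length)
open import Data.List.Relation.Unary.All using (All)
open import Data.List.Relation.Unary.Unique.Propositional using (Unique)
open import Data.Product using (Σ; ∃; _×_; _,_)
open import Relation.Binary.PropositionalEquality using (_≡_; _≢_)
open import Function.Definitions using (Injective)

-- A bipartition of ℕ into V = {x | side x ≡ true} and W = {x | side x ≡ false}.
-- Both classes infinite.
Infinite : (ℕ → Set) → Set
Infinite A = ∀ n → ∃ λ m → n ≤ m × A m

Adj : (ℕ → Bool) → ℕ → ℕ → Set
Adj side x y = side x ≢ side y

-- A k-edge-colouring of K_{V,W}: a colour for each unordered pair
-- (symmetric function); only its values on edges matter.
record Colouring (k : ℕ) : Set where
  field
    col  : ℕ → ℕ → Fin k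
    symm : ∀ x y → col x y ≡ col y x
open Colouring public

-- Upper density of a set A ⊆ ℕ is at most 1/k:
--   ∀ m ≥ 1, eventually |A ∩ {1..n}| / n ≤ 1/k + 1/m,
-- where "|A ∩ {1..n}| ≤ b" is stated as: every duplicate-free list of
-- elements of A ∩ {1..n} has length ≤ b.
InSegment : (ℕ → Set) → ℕ → ℕ → Set
InSegment A n x = 1 ≤ x × x ≤ n × A x

UpperDensity≤1/ : (ℕ → Set) → ℕ → Set
UpperDensity≤1/ A k =
  ∀ (m : ℕ) → 1 ≤ m → ∃ λ N → ∀ n → N ≤ n →
    ∀ (xs : List ℕ) → Unique xs → All (InSegment A n) xs →
      k * m * length xs ≤ m * n + k * n

record FinMonoPath {k : ℕ} (side : ℕ → Bool) (c : Colouring k) : Set where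
  field
    len    : ℕ
    vert   : Fin (suc len) → ℕ
    inj    : Injective _≡_ _≡_ vert
    colour : Fin k
    adj    : ∀ (i : Fin len) → Adj side (vert (inject₁ i)) (vert (fsuc i))
    mono   : ∀ (i : Fin len) → col c (vert (inject₁ i)) (vert (fsuc i)) ≡ colour

record InfMonoPath {k : ℕ} (side : ℕ → Bool) (c : Colouring k) : Set where
  field
    vert   : ℕ → ℕ
    inj    : Injective _≡_ _≡_ vert
    colour : Fin k
    adj    : ∀ i → Adj side (vert i) (vert (suc i))
    mono   : ∀ i → col c (vert i) (vert (suc i)) ≡ colour

FinVerts : ∀ {k} {side : ℕ → Bool} {c : Colouring k} → FinMonoPath side c → ℕ → Set
FinVerts P x = ∃ λ i → FinMonoPath.vert P i ≡ x

InfVerts : ∀ {k} {side : ℕ → Bool} {c : Colouring k} → InfMonoPath side c → ℕ → Set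
InfVerts P x = ∃ λ i → InfMonoPath.vert P i ≡ x

{-# OPTIONS --safe #-}
module Submission where

-- Number the vertices of each side increasingly and let rank x be the position of x
-- within its side; colour xy with (rank x + rank y) mod k.  If x₀ x₁ x₂ … is a
-- monochromatic path, then x_{i+2} lies on the same side as x_i, and cancelling
-- rank x_{i+1} from the equal colours of x_i x_{i+1} and x_{i+1} x_{i+2} gives
-- rank x_{i+2} ≡ rank x_i (mod k).  So the path stays inside two residue classes of
-- rank, one on each side; such a class meets {0, …, n} in at most c/k + 1 vertices
-- when its side does in c of them, so the path has at most (n + 1)/k + 2 vertices
-- there, which is density at most 1/k.

open import Defs
open import Data.Bool using (Bool; true; false; not; if_then_else_)
open import Data.Bool.Properties using (¬-not) renaming (_≟_ to _≟ᵇ_)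
open import Data.Empty using (⊥-elim)
open import Data.Fin using (Fin; toℕ; fromℕ<; _↑ˡ_; _↑ʳ_; splitAt) renaming (zero to fzero; suc to fsuc)
import Data.Fin.Properties as Fin
open import Data.List using (List; length; lookup)
open import Data.List.Relation.Unary.All using (All; _∷_)
open import Data.List.Relation.Unary.AllPairs using (_∷_)
open import Data.List.Relation.Unary.Unique.Propositional using (Unique)
open import Data.Nat using (ℕ; zero; suc; _+_; _*_; _≤_; _<_; _≤?_; s≤s; NonZero; >-nonZero; _/_; _%_)
open import Data.Nat.DivMod using (_mod_; m≡m%n+[m/n]*n; m/n*n≤m; /-monoˡ-≤; [m+kn]%n≡m%n; %-distribˡ-+)
open import Data.Nat.Properties
open import Algebra.Properties.CommutativeSemigroup +-commutativeSemigroup using (interchange)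
open import Data.Product using (Σ; _×_; _,_)
open import Data.Sum using (_⊎_; inj₁; inj₂) renaming (map to ⊎-map)
open import Relation.Binary using (tri<; tri≈; tri>)
open import Relation.Binary.PropositionalEquality
open import Relation.Nullary using (yes; no; does)

record Encoding {A : Set} (P : A → Set) (M : ℕ) : Set where
  field
    code      : ∀ {x} → P x → Fin M
    injective : ∀ {x y} (p : P x) (q : P y) → code p ≡ code q → x ≡ y
open Encoding

module _ {A : Set} where

  All-lookupAt : {P : A → Set} {xs : List A} → All P xs → (i : Fin (length xs)) → P (lookup xs i)
  All-lookupAt (p ∷ _)  fzero    = p
  All-lookupAt (_ ∷ ps) (fsuc i) = All-lookupAt ps i

  Unique-lookup-injective : {xs : List A} → Unique xs → ∀ i j → lookup xs i ≡ lookup xs j → i ≡ j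
  Unique-lookup-injective (_ ∷ _)  fzero    fzero    _  = refl
  Unique-lookup-injective (x∉ ∷ _) fzero    (fsuc j) eq = ⊥-elim (All-lookupAt x∉ j eq)
  Unique-lookup-injective (x∉ ∷ _) (fsuc i) fzero    eq = ⊥-elim (All-lookupAt x∉ i (sym eq))
  Unique-lookup-injective (_ ∷ u)  (fsuc i) (fsuc j) eq = cong fsuc (Unique-lookup-injective u i j eq)

  Encoding-length≤ : {P : A → Set} {M : ℕ} {xs : List A} →
                     Encoding P M → Unique xs → All P xs → length xs ≤ M
  Encoding-length≤ {M = M} {xs} e u ps with length xs ≤? M
  ... | yes ≤M = ≤M
  ... | no ≰M with i , j , i<j , eq ← Fin.pigeonhole (≰⇒> ≰M) (λ i → code e (All-lookupAt ps i)) =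
    ⊥-elim (Fin.<-irrefl (Unique-lookup-injective u i j (injective e _ _ eq)) i<j)

  Encoding-⊆ : {P Q : A → Set} {M : ℕ} → (∀ {x} → P x → Q x) → Encoding Q M → Encoding P M
  Encoding-⊆ P⊆Q e = record
    { code      = λ p → code e (P⊆Q p)
    ; injective = λ p q → injective e (P⊆Q p) (P⊆Q q)
    }

  Encoding-⊎ : {P Q : A → Set} {M₁ M₂ : ℕ} →
               Encoding P M₁ → Encoding Q M₂ → Encoding (λ x → P x ⊎ Q x) (M₁ + M₂)
  Encoding-⊎ {M₁ = M₁} {M₂} e₁ e₂ = record { code = codeᵤ ; injective = injectiveᵤ }
    where
    codeᵤ : ∀ {x} → _ ⊎ _ → Fin (M₁ + M₂)
    codeᵤ (inj₁ p) = code e₁ p ↑ˡ M₂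
    codeᵤ (inj₂ q) = M₁ ↑ʳ code e₂ q

    ↑ˡ≢↑ʳ : ∀ (i : Fin M₁) (j : Fin M₂) → i ↑ˡ M₂ ≢ M₁ ↑ʳ j
    ↑ˡ≢↑ʳ i j eq with () ← trans (sym (Fin.splitAt-↑ˡ M₁ i M₂))
                                   (trans (cong (splitAt M₁) eq) (Fin.splitAt-↑ʳ M₁ M₂ j))

    injectiveᵤ : ∀ {x y} (p : _ ⊎ _) (q : _ ⊎ _) → codeᵤ {x} p ≡ codeᵤ {y} q → x ≡ y
    injectiveᵤ (inj₁ p) (inj₁ q) eq = injective e₁ p q (Fin.↑ˡ-injective M₂ _ _ eq)
    injectiveᵤ (inj₂ p) (inj₂ q) eq = injective e₂ p q (Fin.↑ʳ-injective M₁ _ _ eq)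
    injectiveᵤ (inj₁ p) (inj₂ q) eq = ⊥-elim (↑ˡ≢↑ʳ _ _ eq)
    injectiveᵤ (inj₂ p) (inj₁ q) eq = ⊥-elim (↑ˡ≢↑ʳ _ _ (sym eq))

upperDensity≤1/-byEncoding : {A : ℕ → Set} (k : ℕ) .{{_ : NonZero k}} (c : ℕ) (M : ℕ → ℕ) →
                             (∀ n → Encoding (InSegment A n) (M n)) → (∀ n → k * M n ≤ n + c) →
                             UpperDensity≤1/ A k
upperDensity≤1/-byEncoding k c M enc bound m _ = m * c , λ n mc≤n xs u all → begin
  k * m * length xs    ≡⟨ cong (_* length xs) (*-comm k m) ⟩
  m * k * length xs    ≡⟨ *-assoc m k (length xs) ⟩
  m * (k * length xs)  ≤⟨ *-monoʳ-≤ m (≤-trans (*-monoʳ-≤ k (Encoding-length≤ (enc n) u all)) (bound n)) ⟩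
  m * (n + c)          ≡⟨ *-distribˡ-+ m n c ⟩
  m * n + m * c        ≤⟨ +-monoʳ-≤ (m * n) (≤-trans mc≤n (m≤n*m n k)) ⟩
  m * n + k * n        ∎
  where open ≤-Reasoning

%-cancelʳ-+ : ∀ k .{{_ : NonZero k}} a b c → (a + b) % k ≡ (c + b) % k → a % k ≡ c % k
%-cancelʳ-+ k@(suc k-1) a b c eq = begin
  a % k                                  ≡⟨ complete a ⟩
  (a + b + b * k-1) % k                  ≡⟨ %-distribˡ-+ (a + b) (b * k-1) k ⟩
  ((a + b) % k + (b * k-1) % k) % k      ≡⟨ cong (λ v → (v + (b * k-1) % k) % k) eq ⟩
  ((c + b) % k + (b * k-1) % k) % k      ≡⟨ %-distribˡ-+ (c + b) (b * k-1) k ⟨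
  (c + b + b * k-1) % k                  ≡⟨ complete c ⟨
  c % k                                  ∎
  where
  open ≡-Reasoning
  -- b + b * (k - 1) = b * k vanishes modulo k
  complete : ∀ x → x % k ≡ (x + b + b * k-1) % k
  complete x = begin
    x % k                    ≡⟨ [m+kn]%n≡m%n x b k ⟨
    (x + b * k) % k          ≡⟨ cong (λ v → (x + v) % k) (*-suc b k-1) ⟩
    (x + (b + b * k-1)) % k  ≡⟨ cong (_% k) (+-assoc x b (b * k-1)) ⟨
    (x + b + b * k-1) % k    ∎

divMod-injective : ∀ k .{{_ : NonZero k}} {a b} → a / k ≡ b / k → a % k ≡ b % k → a ≡ b
divMod-injective k {a} {b} q r = begin
  a                  ≡⟨ m≡m%n+[m/n]*n a k ⟩
  a % k + a / k * k  ≡⟨ cong₂ (λ r q → r + q * k) r q ⟩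
  b % k + b / k * k  ≡⟨ m≡m%n+[m/n]*n b k ⟨
  b                  ∎
  where open ≡-Reasoning

*-suc-/-≤ : ∀ k .{{_ : NonZero k}} m → k * suc (m / k) ≤ m + k
*-suc-/-≤ k m = begin
  k * suc (m / k)  ≡⟨ *-suc k (m / k) ⟩
  k + k * (m / k)  ≡⟨ cong (k +_) (*-comm k (m / k)) ⟩
  k + m / k * k    ≤⟨ +-monoʳ-≤ k (m/n*n≤m m k) ⟩
  k + m            ≡⟨ +-comm k m ⟩
  m + k            ∎
  where open ≤-Reasoning

FinVerts-encoding : ∀ {k side} {c : Colouring k} (P : FinMonoPath side c) →
                    Encoding (FinVerts P) (suc (FinMonoPath.len P))
FinVerts-encoding P = record
  { code      = λ (i , _) → i
  ; injective = λ { (_ , refl) (_ , refl) eq → cong (FinMonoPath.vert P) eq }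
  }

FinMonoPath-upperDensity : ∀ k .{{_ : NonZero k}} {side} {c : Colouring k} (P : FinMonoPath side c) →
                           UpperDensity≤1/ (FinVerts P) k
FinMonoPath-upperDensity k P =
  upperDensity≤1/-byEncoding k (k * vertexCount) (λ _ → vertexCount)
    (λ _ → Encoding-⊆ (λ (_ , _ , v) → v) (FinVerts-encoding P)) (λ n → m≤n+m (k * vertexCount) n)
  where
  vertexCount : ℕ
  vertexCount = suc (FinMonoPath.len P)

module RankColouring (side : ℕ → Bool) (k : ℕ) .{{_ : NonZero k}} where

  countBelow : Bool → ℕ → ℕ
  countBelow b zero    = zero
  countBelow b (suc x) = if does (side x ≟ᵇ b) then suc (countBelow b x) else countBelow b x

  countBelow-suc : ∀ {b x} → side x ≡ b → countBelow b (suc x) ≡ suc (countBelow b x)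
  countBelow-suc {b} {x} eq with side x ≟ᵇ b
  ... | yes _ = refl
  ... | no ≢b = ⊥-elim (≢b eq)

  countBelow-≤-suc : ∀ b x → countBelow b x ≤ countBelow b (suc x)
  countBelow-≤-suc b x with side x ≟ᵇ b
  ... | yes _ = n≤1+n (countBelow b x)
  ... | no _  = ≤-refl

  countBelow-< : ∀ {b x y} → side x ≡ b → x < y → countBelow b x < countBelow b y
  countBelow-< {b} {x} {suc y} sx (s≤s x≤y) with m≤n⇒m<n∨m≡n x≤y
  ... | inj₁ x<y  = <-≤-trans (countBelow-< sx x<y) (countBelow-≤-suc b y)
  ... | inj₂ refl = ≤-reflexive (sym (countBelow-suc sx))

  countBelow-true+false : ∀ n → countBelow true n + countBelow false n ≡ n
  countBelow-true+false zero = refl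
  countBelow-true+false (suc n) with side n
  ... | true  = cong suc (countBelow-true+false n)
  ... | false = trans (+-suc (countBelow true n) (countBelow false n)) (cong suc (countBelow-true+false n))

  countBelow-+-not : ∀ b n → countBelow b n + countBelow (not b) n ≡ n
  countBelow-+-not true  n = countBelow-true+false n
  countBelow-+-not false n = trans (+-comm (countBelow false n) (countBelow true n)) (countBelow-true+false n)

  rank : ℕ → ℕ
  rank x = countBelow (side x) x

  rank<countBelow : ∀ {b x n} → side x ≡ b → x < n → rank x < countBelow b n
  rank<countBelow refl = countBelow-< refl

  rank-injective : ∀ {x y} → side x ≡ side y → rank x ≡ rank y → x ≡ y
  rank-injective {x} {y} sx≡sy eq with <-cmp x y
  ... | tri< x<y _ _ = ⊥-elim (<⇒≢ (rank<countBelow sx≡sy x<y) eq)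
  ... | tri≈ _ x≡y _ = x≡y
  ... | tri> _ _ y<x = ⊥-elim (<⇒≢ (rank<countBelow (sym sx≡sy) y<x) (sym eq))

  colouring : Colouring k
  colouring = record
    { col  = λ x y → (rank x + rank y) mod k
    ; symm = λ x y → cong (_mod k) (+-comm (rank x) (rank y))
    }

  residue : ℕ → ℕ
  residue x = rank x % k

  residue-cancel : ∀ {x y z} → col colouring x y ≡ col colouring z y → residue x ≡ residue z
  residue-cancel {x} {y} {z} eq = %-cancelʳ-+ k (rank x) (rank y) (rank z) (begin
    (rank x + rank y) % k         ≡⟨ Fin.toℕ-fromℕ< _ ⟨
    toℕ (col colouring x y)       ≡⟨ cong toℕ eq ⟩
    toℕ (col colouring z y)       ≡⟨ Fin.toℕ-fromℕ< _ ⟩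
    (rank z + rank y) % k         ∎)
    where open ≡-Reasoning

  SameClass : ℕ → ℕ → Set
  SameClass x y = side x ≡ side y × residue x ≡ residue y

  SameClass-trans : ∀ {x y z} → SameClass x y → SameClass y z → SameClass x z
  SameClass-trans (s₁ , r₁) (s₂ , r₂) = trans s₁ s₂ , trans r₁ r₂

  classBelowEncoding : ∀ y n → Encoding (λ x → x < n × SameClass x y) (suc (countBelow (side y) n / k))
  classBelowEncoding y n = record { code = codeᶜ ; injective = injectiveᶜ }
    where
    quotient< : ∀ {x} → x < n × SameClass x y → rank x / k < suc (countBelow (side y) n / k)
    quotient< (x<n , sx , _) = s≤s (/-monoˡ-≤ k (<⇒≤ (rank<countBelow sx x<n)))

    codeᶜ : ∀ {x} → x < n × SameClass x y → Fin (suc (countBelow (side y) n / k))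
    codeᶜ p = fromℕ< (quotient< p)

    injectiveᶜ : ∀ {x x′} (p : x < n × SameClass x y) (q : x′ < n × SameClass x′ y) → codeᶜ p ≡ codeᶜ q → x ≡ x′
    injectiveᶜ {x} {x′} p@(_ , sx , rx) q@(_ , sx′ , rx′) eq =
      rank-injective (trans sx (sym sx′)) (divMod-injective k sameQuotient (trans rx (sym rx′)))
      where
      sameQuotient : rank x / k ≡ rank x′ / k
      sameQuotient = trans (sym (Fin.toℕ-fromℕ< (quotient< p))) (trans (cong toℕ eq) (Fin.toℕ-fromℕ< (quotient< q)))

  module _ (P : InfMonoPath side colouring) where
    open InfMonoPath P

    SameClass-+2 : ∀ i → SameClass (vert (suc (suc i))) (vert i)
    SameClass-+2 i = sameSide , residue-cancel {vert (suc (suc i))} {vert (suc i)} {vert i} sameColour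
      where
      sameSide : side (vert (suc (suc i))) ≡ side (vert i)
      sameSide = trans (¬-not (≢-sym (adj (suc i)))) (sym (¬-not (adj i)))

      sameColour : col colouring (vert (suc (suc i))) (vert (suc i)) ≡ col colouring (vert i) (vert (suc i))
      sameColour = trans (symm colouring (vert (suc (suc i))) (vert (suc i))) (trans (mono (suc i)) (sym (mono i)))

    SameClass-vert₀⊎vert₁ : ∀ i → SameClass (vert i) (vert 0) ⊎ SameClass (vert i) (vert 1)
    SameClass-vert₀⊎vert₁ zero          = inj₁ (refl , refl)
    SameClass-vert₀⊎vert₁ (suc zero)    = inj₂ (refl , refl)
    SameClass-vert₀⊎vert₁ (suc (suc i)) =
      ⊎-map (SameClass-trans (SameClass-+2 i)) (SameClass-trans (SameClass-+2 i)) (SameClass-vert₀⊎vert₁ i)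

    classesBelow : ℕ → ℕ
    classesBelow n = suc (countBelow (side (vert 0)) n / k) + suc (countBelow (side (vert 1)) n / k)

    InfVerts-encoding : ∀ n → Encoding (InSegment (InfVerts P) n) (classesBelow (suc n))
    InfVerts-encoding n =
      Encoding-⊆ split (Encoding-⊎ (classBelowEncoding (vert 0) (suc n)) (classBelowEncoding (vert 1) (suc n)))
      where
      split : ∀ {x} → InSegment (InfVerts P) n x →
              (x < suc n × SameClass x (vert 0)) ⊎ (x < suc n × SameClass x (vert 1))
      split (_ , x≤n , i , refl) = ⊎-map (s≤s x≤n ,_) (s≤s x≤n ,_) (SameClass-vert₀⊎vert₁ i)

    classesBelow-bound : ∀ n → k * classesBelow n ≤ n + (k + k)
    classesBelow-bound n = begin
      k * (suc (c₀ / k) + suc (c₁ / k))    ≡⟨ *-distribˡ-+ k (suc (c₀ / k)) (suc (c₁ / k)) ⟩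
      k * suc (c₀ / k) + k * suc (c₁ / k)  ≤⟨ +-mono-≤ (*-suc-/-≤ k c₀) (*-suc-/-≤ k c₁) ⟩
      (c₀ + k) + (c₁ + k)                  ≡⟨ interchange c₀ k c₁ k ⟩
      (c₀ + c₁) + (k + k)                  ≡⟨ cong (_+ (k + k)) sides-partition ⟩
      n + (k + k)                          ∎
      where
      open ≤-Reasoning
      c₀ c₁ : ℕ
      c₀ = countBelow (side (vert 0)) n
      c₁ = countBelow (side (vert 1)) n
      sides-partition : c₀ + c₁ ≡ n
      sides-partition = trans (cong (λ b → c₀ + countBelow b n) (¬-not (≢-sym (adj 0))))
                              (countBelow-+-not (side (vert 0)) n)

    InfMonoPath-upperDensity : UpperDensity≤1/ (InfVerts P) k
    InfMonoPath-upperDensity = upperDensity≤1/-byEncoding k (suc (k + k)) (λ n → classesBelow (suc n))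
      InfVerts-encoding (λ n → ≤-trans (classesBelow-bound (suc n)) (≤-reflexive (sym (+-suc n (k + k)))))

proposition1p4 : (side : ℕ → Bool) →
    Infinite (λ x → side x ≡ true) → Infinite (λ x → side x ≡ false) →
    (k : ℕ) → 1 ≤ k →
    Σ (Colouring k) λ c →
      ((P : FinMonoPath side c) → UpperDensity≤1/ (FinVerts P) k) ×
      ((P : InfMonoPath side c) → UpperDensity≤1/ (InfVerts P) k)
-- The colouring works for every bipartition: neither side needs to be infinite.
proposition1p4 side _ _ k 1≤k = colouring , FinMonoPath-upperDensity k , InfMonoPath-upperDensity
  where
  instance
    k≢0 : NonZero k
    k≢0 = >-nonZero 1≤k
  open RankColouring side k
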